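{- Let $m\ge 6$, $X=\mathbb{F}_{2^m}\setminus\{0,1\}$, and let $W_6$ be as in the context. Then every element $x\in X$ lies in exactly $r_6=\frac{(2^m-4)(2^m-8)(2^m-16)(2^m-32)}{5!}$ blocks of $W_6$ (the repetition number of $(X,W_2,W_6)$), and $|W_6|=\frac{(2^m-2)(2^m-4)(2^m-8)(2^m-16)(2^m-32)}{6!}$.
   Context: $\mathbb{F}_{2^m}$ is the finite field with $2^m$ elements, with zero $0$ and unity $1$; all sums are in $\mathbb{F}_{2^m}$. For each integer $k\ge 2$, $W_k=\{B\subset X : |B|=k,\ \sum_{i\in B} i=1,\ \text{and } \binom{B}{\ell}\cap W_\ell=\emptyset \text{ for all } 2\le \ell\le k-3\}$ (recursive definition; $\binom{B}{\ell}$ is the set of $\ell$-subsets of $B$). -}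

module Defs where

open import Level using (0ℓ)
open import Data.Nat using (ℕ; zero; suc; _≤_) renaming (_+_ to _+ℕ_)
open import Data.Fin using (Fin)
import Data.Fin as Fin
open import Data.Fin.Subset using (Subset; _∈_; _⊆_; ∣_∣)
open import Data.Vec using (Vec; []; _∷_)
open import Data.Bool using (true; false)
open import Data.Product using (Σ; _×_)
open import Data.Empty using (⊥)
open import Relation.Nullary using (¬_)
open import Relation.Binary.PropositionalEquality using (_≡_)
open import Algebra.Structures using (IsCommutativeRing)
open import Function.Bundles using (_↔_)
open import Function.Base using (_∘_)

record FiniteField (q : ℕ) : Set₁ where
  infixl 6 _+_
  infixl 7 _*_
  field
    Carrier : Set
    _+_ _*_ : Carrier → Carrier → Carrier
    -_      : Carrier → Carrier
    0# 1#   : Carrier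
    isCommutativeRing : IsCommutativeRing _≡_ _+_ _*_ -_ 0# 1#
    0≢1     : ¬ (0# ≡ 1#)
    inverse : ∀ x → ¬ (x ≡ 0#) → Σ Carrier (λ y → x * y ≡ 1#)
    enum    : Fin q ↔ Carrier

module _ {q : ℕ} (F : FiniteField q) where
  open FiniteField F
  open Function.Bundles.Inverse enum using (to)

  sumOver : ∀ {n} → (Fin n → Carrier) → Subset n → Carrier
  sumOver f []           = 0#
  sumOver f (true  ∷ B)  = f Fin.zero + sumOver (f ∘ Fin.suc) B
  sumOver f (false ∷ B)  = sumOver (f ∘ Fin.suc) B

  -- Σ_{i ∈ B} i, where subsets of the field are subsets of indices Fin q
  elemSum : Subset q → Carrier
  elemSum = sumOver to

  InX : Subset q → Set
  InX B = ∀ i → i ∈ B → ¬ (to i ≡ 0#) × ¬ (to i ≡ 1#)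

  -- Auxiliary fuelled version of the recursive definition of W_k.
  -- The recursion only calls W_ℓ with ℓ ≤ k - 3, so fuel k is always enough.
  Wf : ℕ → ℕ → Subset q → Set
  Wf zero    k B = ⊥
  Wf (suc f) k B =
    InX B × ∣ B ∣ ≡ k × elemSum B ≡ 1# ×
    (∀ ℓ → 2 ≤ ℓ → ℓ +ℕ 3 ≤ k → ∀ C → C ⊆ B → ∣ C ∣ ≡ ℓ → ¬ Wf f ℓ C)

  W : ℕ → Subset q → Set
  W k = Wf k k

-- "Exactly N elements of A satisfy P": an injective enumeration Fin N → A
-- whose image is exactly {a | P a}.  (Phrased this way rather than as a
-- bijection with a Σ-type so that proof-relevance of P plays no role.)
open import Function.Definitions using (Injective)

CountIs : {A : Set} → (A → Set) → ℕ → Set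
CountIs {A} P N =
  Σ (Fin N → A) (λ f → Injective _≡_ _≡_ f × (∀ i → P (f i)) × (∀ a → P a → Σ (Fin N) (λ i → f i ≡ a)))

module Submission where

-- Let F be a finite field of characteristic two; a field of
-- order 2^m is one, since otherwise x ↦ -x would be an involution of F fixing
-- only 0 and |F| would be odd.  Subset sums in F are then 𝔽₂-linear
-- combinations; call a set independent if only its empty subset sums to 0.
--   * An independent set A spans exactly 2^|A| elements, so exactly q - 2^|A|
--     elements y keep A ∪ {y} independent.  Double counting pairs (S, y ∈ S)
--     gives  k! · #{k-sets S : A ∪ S independent} = ∏_{i<k} (q - 2^(|A|+i)).
--   * B ∈ W₆ iff |B| = 6, ΣB = 1 and no nonempty subset of size ≤ 5 sums to 0
--     or 1 (small subsets are controlled by X, W₂ and W₃, large ones through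
--     their complement in B).  For such B and y ∈ B, {1} ∪ (B - y) is
--     independent, and every 5-set S with {1} ∪ S independent arises from
--     exactly one pair (B, y), namely with y = 1 + ΣS.
--   Hence 6·|W₆| = #{5-sets S : {1} ∪ S independent} and, for x ∈ X,
--   5·#{B ∈ W₆ : x ∈ B} = #{4-sets S : {1, x} ∪ S independent}; the first
--   bullet evaluates both.

open import Defs
open import Data.Nat using (ℕ; _≤_; _^_; _∸_; _*_; _/_)
open import Data.Fin using (Fin)
open import Data.Fin.Subset using (Subset; _∈_)
open import Data.Product using (_×_; _,_)
open import Relation.Nullary using (¬_)
open import Relation.Binary.PropositionalEquality using (_≡_)
open import Function.Bundles using (Inverse)
open import Data.Nat using (zero; suc)
open import Relation.Binary.PropositionalEquality using (refl)

module Counting where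
  open import Data.Nat using (zero; suc; _+_; _<_)
  open import Data.Nat.Properties
    using (≤-antisym; +-comm; +-identityʳ; m+n∸m≡n; m+[n∸m]≡n; m∸n≤m; <-asym; ≤∧≢⇒<; ≮⇒≥; _<?_)
  open import Data.Fin using (zero; suc; toℕ; _≟_; join; splitAt; _↑ˡ_; _↑ʳ_; combine; remQuot)
  open import Data.Fin.Properties
    using (injective⇒≤; toℕ-injective; suc-injective; join-splitAt; splitAt-↑ˡ; splitAt-↑ʳ; remQuot-combine; combine-remQuot)
  open import Data.Vec using (Vec; []; _∷_)
  open import Data.Vec.Properties using (∷-injectiveʳ)
  open import Data.Bool using (Bool; true; false)
  open import Data.Product using (Σ; proj₁; proj₂)
  open import Data.Sum using (_⊎_; inj₁; inj₂)
  open import Data.Unit using (⊤; tt)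
  open import Data.Empty using (⊥-elim)
  open import Relation.Nullary using (yes; no; ¬?)
  open import Relation.Nullary.Decidable using (_×-dec_)
  open import Relation.Unary using (Decidable)
  open import Relation.Binary.PropositionalEquality using (refl; sym; trans; cong; cong₂; subst)
  open import Function.Definitions using (Injective)

  private variable
    A B : Set
    P Q R : A → Set
    N M n : ℕ

  -- Two enumerations of the same predicate have the same length: mapping the
  -- first into the second is injective.
  count-≤ : CountIs P N → CountIs P M → N ≤ M
  count-≤ (f , f-inj , fP , _) (g , _ , _ , g-onto) =
    injective⇒≤ {f = λ i → index i} λ {i} {j} e →
      f-inj (trans (sym (index-ok i)) (trans (cong g e) (index-ok j)))
    where
    index : ∀ i → Fin _
    index i = proj₁ (g-onto (f i) (fP i))
    index-ok : ∀ i → g (index i) ≡ f i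
    index-ok i = proj₂ (g-onto (f i) (fP i))

  count-unique : CountIs P N → CountIs P M → N ≡ M
  count-unique C D = ≤-antisym (count-≤ C D) (count-≤ D C)

  count-⇔ : (∀ a → P a → Q a) → (∀ a → Q a → P a) → CountIs P N → CountIs Q N
  count-⇔ pq qp (f , f-inj , fP , f-onto) = f , f-inj , (λ i → pq _ (fP i)) , λ a q → f-onto a (qp a q)

  count-bijection : (h : A → B) (h⁻¹ : B → A) → (∀ a → P a → Q (h a)) → (∀ b → Q b → P (h⁻¹ b))
    → (∀ a → P a → h⁻¹ (h a) ≡ a) → (∀ b → Q b → h (h⁻¹ b) ≡ b) → CountIs P N → CountIs Q N
  count-bijection h h⁻¹ pq qp h⁻¹h hh⁻¹ (f , f-inj , fP , f-onto) =
    (λ i → h (f i)) ,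
    (λ {i} {j} e → f-inj (trans (sym (h⁻¹h _ (fP i))) (trans (cong h⁻¹ e) (h⁻¹h _ (fP j))))) ,
    (λ i → pq _ (fP i)) ,
    λ b q → let (i , e) = f-onto (h⁻¹ b) (qp b q) in i , trans (cong h e) (hh⁻¹ b q)

  count-image : (h : A → B) → (∀ a a' → P a → P a' → h a ≡ h a' → a ≡ a') → CountIs P N
    → CountIs (λ b → Σ A (λ a → P a × h a ≡ b)) N
  count-image h h-inj (f , f-inj , fP , f-onto) =
    (λ i → h (f i)) , (λ {i} {j} e → f-inj (h-inj _ _ (fP i) (fP j) e)) , (λ i → f i , fP i , refl) ,
    λ { b (a , p , refl) → let (i , e) = f-onto a p in i , cong h e }

  count-none : (∀ a → ¬ P a) → CountIs P 0
  count-none ¬P = (λ ()) , (λ {}) , (λ ()) , λ a p → ⊥-elim (¬P a p)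

  count-zero⇒none : CountIs P 0 → ∀ a → ¬ P a
  count-zero⇒none (_ , _ , _ , onto) a p with onto a p
  ... | () , _

  count-singleton : (a : A) → CountIs (_≡ a) 1
  count-singleton a = (λ _ → a) , (λ { {zero} {zero} _ → refl }) , (λ _ → refl) , λ { _ refl → zero , refl }

  count-everything : CountIs {Fin n} (λ _ → ⊤) n
  count-everything = (λ i → i) , (λ e → e) , (λ _ → tt) , λ a _ → a , refl

  count-Fin-cons-yes : {P : Fin (suc n) → Set} → P zero → CountIs (λ i → P (suc i)) N → CountIs P (suc N)
  count-Fin-cons-yes {P = P} p0 (f , f-inj , fP , f-onto) = g , g-inj , gP , g-onto
    where
    g : Fin (suc _) → Fin (suc _)
    g zero    = zero
    g (suc j) = suc (f j)
    g-inj : Injective _≡_ _≡_ g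
    g-inj {zero}  {zero}  _ = refl
    g-inj {suc i} {suc j} e = cong suc (f-inj (suc-injective e))
    g-inj {zero}  {suc j} ()
    g-inj {suc i} {zero}  ()
    gP : ∀ i → P (g i)
    gP zero    = p0
    gP (suc i) = fP i
    g-onto : ∀ a → P a → Σ _ (λ i → g i ≡ a)
    g-onto zero    _ = zero , refl
    g-onto (suc a) p = let (i , e) = f-onto a p in suc i , cong suc e

  count-Fin-cons-no : {P : Fin (suc n) → Set} → ¬ P zero → CountIs (λ i → P (suc i)) N → CountIs P N
  count-Fin-cons-no {P = P} ¬p0 (f , f-inj , fP , f-onto) =
    (λ i → suc (f i)) , (λ e → f-inj (suc-injective e)) , fP , g-onto
    where
    g-onto : ∀ a → P a → Σ _ (λ i → suc (f i) ≡ a)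
    g-onto zero    p = ⊥-elim (¬p0 p)
    g-onto (suc a) p = let (i , e) = f-onto a p in i , cong suc e

  count-Fin : (P : Fin n → Set) → Decidable P →
    Σ ℕ λ a → Σ ℕ λ b → CountIs P a × CountIs (λ i → ¬ P i) b × a + b ≡ n
  count-Fin {zero} P P? = 0 , 0 , count-none (λ ()) , count-none (λ ()) , refl
  count-Fin {suc n} P P? with count-Fin (λ i → P (suc i)) (λ i → P? (suc i)) | P? zero
  ... | a , b , C , D , e | yes p =
    suc a , b , count-Fin-cons-yes p C , count-Fin-cons-no (λ ¬p → ¬p p) D , cong suc e
  ... | a , b , C , D , e | no ¬p =
    a , suc b , count-Fin-cons-no ¬p C , count-Fin-cons-yes ¬p D ,
    trans (+-comm a (suc b)) (cong suc (trans (+-comm b a) e))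

  count-within : (C : CountIs Q M) → CountIs (λ i → R (proj₁ C i)) N → CountIs (λ x → Q x × R x) N
  count-within {R = R} (f , f-inj , fQ , f-onto) (g , g-inj , gR , g-onto) =
    (λ i → f (g i)) , (λ e → g-inj (f-inj e)) , (λ i → fQ (g i) , gR i) ,
    λ x (q , r) → let (i , e) = f-onto x q in
                  let (j , e') = g-onto i (subst R (sym e) r) in j , trans (cong f e') e

  count-complement : {P : A → Set} → CountIs Q M → Decidable P → CountIs (λ a → Q a × P a) N
    → CountIs (λ a → Q a × ¬ P a) (M ∸ N)
  count-complement {P = P} C@(f , _) P? S with count-Fin (λ i → P (f i)) (λ i → P? (f i))
  ... | a , b , CP , CN , e =
    subst (CountIs _) (trans (sym (m+n∸m≡n a b)) (cong₂ _∸_ e (count-unique (count-within C CP) S)))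
      (count-within C CN)

  count-pairs : {Q : A → B → Set} {k : ℕ} → CountIs P n → (∀ a → P a → CountIs (Q a) k)
    → CountIs (λ (ab : A × B) → P (proj₁ ab) × Q (proj₁ ab) (proj₂ ab)) (n * k)
  count-pairs {A = A} {B = B} {P = P} {n = n} {Q = Q} {k} (f , f-inj , fP , f-onto) fibre =
    e , e-inj , eP , e-onto
    where
    E : Fin n × Fin k → A × B
    E (i , j) = f i , proj₁ (fibre (f i) (fP i)) j
    E-inj : ∀ i j i' j' → E (i , j) ≡ E (i' , j') → (i , j) ≡ (i' , j')
    E-inj i j i' j' eq with f-inj (cong proj₁ eq)
    ... | refl = cong (i ,_) (proj₁ (proj₂ (fibre (f i) (fP i))) (cong proj₂ eq))
    e : Fin (n * k) → A × B
    e x = E (remQuot k x)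
    e-inj : Injective _≡_ _≡_ e
    e-inj {x} {y} eq =
      trans (sym (combine-remQuot {n} k x))
        (trans (cong (λ p → combine (proj₁ p) (proj₂ p)) (E-inj _ _ _ _ eq)) (combine-remQuot {n} k y))
    eP : ∀ x → P (proj₁ (e x)) × Q (proj₁ (e x)) (proj₂ (e x))
    eP x = fP _ , proj₁ (proj₂ (proj₂ (fibre (f _) (fP _)))) _
    e-onto : ∀ ab → P (proj₁ ab) × Q (proj₁ ab) (proj₂ ab) → Σ (Fin (n * k)) (λ x → e x ≡ ab)
    e-onto (a , b) (p , q) with f-onto a p
    ... | i , refl with proj₂ (proj₂ (proj₂ (fibre (f i) (fP i)))) b q
    ... | j , ej = combine i j , trans (cong E (remQuot-combine i j)) (cong (f i ,_) ej)

  count-Subset-cons : {P : Vec Bool (suc n) → Set} → CountIs (λ v → P (true ∷ v)) N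
    → CountIs (λ v → P (false ∷ v)) M → CountIs P (N + M)
  count-Subset-cons {n = n} {N = N} {M = M} {P = P} (f , f-inj , fP , f-onto) (g , g-inj , gP , g-onto) =
    e , e-inj , eP , e-onto
    where
    E : Fin N ⊎ Fin M → Vec Bool (suc n)
    E (inj₁ i) = true ∷ f i
    E (inj₂ j) = false ∷ g j
    E-inj : ∀ x y → E x ≡ E y → x ≡ y
    E-inj (inj₁ i) (inj₁ j) eq = cong inj₁ (f-inj (∷-injectiveʳ eq))
    E-inj (inj₂ i) (inj₂ j) eq = cong inj₂ (g-inj (∷-injectiveʳ eq))
    E-inj (inj₁ i) (inj₂ j) ()
    E-inj (inj₂ i) (inj₁ j) ()
    e : Fin (N + M) → Vec Bool (suc n)
    e x = E (splitAt N x)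
    e-inj : Injective _≡_ _≡_ e
    e-inj {x} {y} eq = trans (sym (join-splitAt N M x)) (trans (cong (join N M) (E-inj _ _ eq)) (join-splitAt N M y))
    eP : ∀ x → P (e x)
    eP x with splitAt N x
    ... | inj₁ i = fP i
    ... | inj₂ j = gP j
    e-onto : ∀ v → P v → Σ (Fin (N + M)) (λ x → e x ≡ v)
    e-onto (true ∷ v) p = let (i , eq) = f-onto v p in
      i ↑ˡ M , trans (cong E (splitAt-↑ˡ N i M)) (cong (true ∷_) eq)
    e-onto (false ∷ v) p = let (i , eq) = g-onto v p in
      N ↑ʳ i , trans (cong E (splitAt-↑ʳ N M i)) (cong (false ∷_) eq)

  count-Subset : (P : Vec Bool n → Set) → Decidable P → Σ ℕ (CountIs P)
  count-Subset {zero} P P? with P? []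
  ... | yes p = 1 , (λ _ → []) , (λ { {zero} {zero} _ → refl }) , (λ _ → p) , λ { [] _ → zero , refl }
  ... | no ¬p = 0 , count-none λ { [] p → ¬p p }
  count-Subset {suc n} P P? =
    let (a , C) = count-Subset (λ v → P (true ∷ v)) (λ v → P? (true ∷ v)) in
    let (b , D) = count-Subset (λ v → P (false ∷ v)) (λ v → P? (false ∷ v)) in
    a + b , count-Subset-cons C D

  -- An involution σ of Fin n with exactly one fixed point z forces n to be
  -- odd: the points i ≠ z with i < σ i and those with i > σ i are swapped by σ,
  -- so they are equally many.
  involution-odd : (σ : Fin n → Fin n) → (∀ i → σ (σ i) ≡ i) → (z : Fin n) → σ z ≡ z
    → (∀ i → σ i ≡ i → i ≡ z) → Σ ℕ λ a → n ≡ suc (2 * a)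
  involution-odd {n = suc n} σ σσ z σz fixed = a , cong suc (trans (sym a+a≡n) (cong (a +_) (sym (+-identityʳ a))))
    where
    Moved : Fin (suc n) → Set
    Moved i = ⊤ × ¬ i ≡ z
    Up : Fin (suc n) → Set
    Up i = toℕ i < toℕ (σ i)
    moved : CountIs Moved n
    moved = count-complement count-everything (_≟ z) (count-⇔ (λ _ → tt ,_) (λ _ → proj₂) (count-singleton z))
    σ-moved : ∀ i → ¬ i ≡ z → ¬ σ i ≡ z
    σ-moved i i≢z e = i≢z (trans (sym (σσ i)) (trans (cong σ e) σz))
    up-count : Σ ℕ (CountIs (λ i → Moved i × Up i))
    up-count with count-Fin (λ i → Moved i × Up i) (λ i → (yes tt ×-dec ¬? (i ≟ z)) ×-dec (toℕ i <? toℕ (σ i)))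
    ... | a , _ , C , _ = a , C
    a : ℕ
    a = proj₁ up-count
    up : CountIs (λ i → Moved i × Up i) a
    up = proj₂ up-count
    down : CountIs (λ i → Moved i × ¬ Up i) (n ∸ a)
    down = count-complement moved (λ i → toℕ i <? toℕ (σ i)) up
    up⇒down : ∀ i → Moved i × Up i → Moved (σ i) × ¬ Up (σ i)
    up⇒down i ((_ , i≢z) , i<σi) =
      (tt , σ-moved i i≢z) , λ σi<i → <-asym i<σi (subst (λ j → toℕ (σ i) < toℕ j) (σσ i) σi<i)
    down⇒up : ∀ i → Moved i × ¬ Up i → Moved (σ i) × Up (σ i)
    down⇒up i ((_ , i≢z) , i≮σi) =
      (tt , σ-moved i i≢z) ,
      subst (λ j → toℕ (σ i) < toℕ j) (sym (σσ i))
        (≤∧≢⇒< (≮⇒≥ i≮σi) λ e → i≢z (fixed i (toℕ-injective e)))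
    a≡n∸a : a ≡ n ∸ a
    a≡n∸a = count-unique (count-bijection σ σ up⇒down down⇒up (λ i _ → σσ i) (λ i _ → σσ i) up) down
    a+a≡n : a + a ≡ n
    a+a≡n = trans (cong (a +_) a≡n∸a) (m+[n∸m]≡n (subst (_≤ n) (sym a≡n∸a) (m∸n≤m n a)))

module Subsets where
  open Counting
  open import Data.Nat using (zero; suc; _+_)
  open import Data.Nat.Properties using (+-suc; +-comm; +-identityʳ; suc-injective)
  open import Data.Fin using (zero; suc; _≟_)
  open import Data.Fin.Subset using (_∉_; _⊆_; ∣_∣; ⁅_⁆; _∪_; _─_; _-_) renaming (⊥ to ∅)
  open import Data.Fin.Subset.Properties
    using (∣⁅x⁆∣≡1; ∣⊥∣≡0; x∈⁅x⁆; x∈⁅y⁆⇒x≡y; x∈p∪q⁻; x∈p∪q⁺; ⊆-antisym; p─q⊆p; x∈p∧x≢y⇒x∈p-y;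
           drop-there; drop-∷-⊆; in⊆in; out⊆; anySubset?)
  open import Data.Vec using ([]; _∷_; here; there; zipWith)
  open import Data.Vec.Properties using (∷-injectiveʳ; ≡-dec)
  open import Data.Bool using (true; false; _xor_)
  import Data.Bool as Bool
  open import Data.Product using (Σ)
  open import Data.Sum using (inj₁; inj₂)
  open import Data.Empty using (⊥-elim)
  open import Relation.Nullary using (Dec; yes; no; ¬?)
  open import Relation.Nullary.Decidable using (decidable-stable)
  open import Relation.Binary.PropositionalEquality using (_≢_; refl; sym; trans; cong; subst)

  private variable
    n : ℕ
    x y : Fin n
    A B C D S : Subset n

  data Partition : Subset n → Subset n → Subset n → Set where
    []  : Partition [] [] []
    inˡ : Partition B C D → Partition (true ∷ B) (true ∷ C) (false ∷ D)
    inʳ : Partition B C D → Partition (true ∷ B) (false ∷ C) (true ∷ D)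
    out : Partition B C D → Partition (false ∷ B) (false ∷ C) (false ∷ D)

  partition-size : Partition B C D → ∣ B ∣ ≡ ∣ C ∣ + ∣ D ∣
  partition-size []      = refl
  partition-size (inˡ p) = cong suc (partition-size p)
  partition-size (inʳ {C = C} {D = D} p) = trans (cong suc (partition-size p)) (sym (+-suc ∣ C ∣ ∣ D ∣))
  partition-size (out p) = partition-size p

  ⊆-partition : C ⊆ B → Partition B C (B ─ C)
  ⊆-partition {C = []}        {B = []}        _ = []
  ⊆-partition {C = true ∷ C}  {B = true ∷ B}  s = inˡ (⊆-partition (drop-∷-⊆ s))
  ⊆-partition {C = false ∷ C} {B = true ∷ B}  s = inʳ (⊆-partition (drop-∷-⊆ s))
  ⊆-partition {C = false ∷ C} {B = false ∷ B} s = out (⊆-partition (drop-∷-⊆ s))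
  ⊆-partition {C = true ∷ C}  {B = false ∷ B} s with s here
  ... | ()

  disjoint-partition : (∀ x → x ∈ C → x ∉ D) → Partition (C ∪ D) C D
  disjoint-partition {C = []}        {D = []}        _ = []
  disjoint-partition {C = true ∷ C}  {D = true ∷ D}  d = ⊥-elim (d zero here here)
  disjoint-partition {C = true ∷ C}  {D = false ∷ D} d = inˡ (disjoint-partition (λ x a b → d (suc x) (there a) (there b)))
  disjoint-partition {C = false ∷ C} {D = true ∷ D}  d = inʳ (disjoint-partition (λ x a b → d (suc x) (there a) (there b)))
  disjoint-partition {C = false ∷ C} {D = false ∷ D} d = out (disjoint-partition (λ x a b → d (suc x) (there a) (there b)))

  partition-∅ : Partition B C ∅ → B ≡ C
  partition-∅ []      = refl
  partition-∅ (inˡ p) = cong (true ∷_) (partition-∅ p)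
  partition-∅ (out p) = cong (false ∷_) (partition-∅ p)

  single-partition : y ∈ S → Partition S ⁅ y ⁆ (S - y)
  single-partition {y = y} y∈S = ⊆-partition λ {z} z∈y → subst (_∈ _) (sym (x∈⁅y⁆⇒x≡y y z∈y)) y∈S

  ∈─⇒∉ : x ∈ B ─ C → x ∉ C
  ∈─⇒∉ {x = zero}  {B = true ∷ B} {C = true ∷ C} () here
  ∈─⇒∉ {x = suc x} {B = _ ∷ B}    {C = _ ∷ C}    (there m) (there m') = ∈─⇒∉ m m'

  ∈-⇒≢ : x ∈ B - y → x ≢ y
  ∈-⇒≢ m refl = ∈─⇒∉ m (x∈⁅x⁆ _)

  ∉∅ : x ∉ ∅ {n}
  ∉∅ {x = suc x} (there m) = ∉∅ m

  ⊆∅⇒≡∅ : C ⊆ ∅ → C ≡ ∅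
  ⊆∅⇒≡∅ s = ⊆-antisym s λ m → ⊥-elim (∉∅ m)

  size≡0⇒≡∅ : ∣ C ∣ ≡ 0 → C ≡ ∅
  size≡0⇒≡∅ {C = []}        _ = refl
  size≡0⇒≡∅ {C = false ∷ C} e = cong (false ∷_) (size≡0⇒≡∅ e)

  nonempty⇒≢∅ : ∀ {n} {C : Subset n} → 1 ≤ ∣ C ∣ → C ≢ ∅
  nonempty⇒≢∅ {n} 1≤∣C∣ refl with subst (1 ≤_) (∣⊥∣≡0 n) 1≤∣C∣
  ... | ()

  size≡suc⇒nonempty : ∀ {k} → ∣ C ∣ ≡ suc k → Σ (Fin n) (_∈ C)
  size≡suc⇒nonempty {C = true ∷ C}  _ = zero , here
  size≡suc⇒nonempty {C = false ∷ C} e = let (x , m) = size≡suc⇒nonempty e in suc x , there m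

  size-remove : y ∈ S → ∣ S ∣ ≡ suc ∣ S - y ∣
  size-remove {y = y} {S = S} m =
    trans (partition-size (single-partition m)) (cong (_+ ∣ S - y ∣) (∣⁅x⁆∣≡1 y))

  insert-partition : y ∉ S → Partition (S ∪ ⁅ y ⁆) S ⁅ y ⁆
  insert-partition {y = y} {S = S} y∉S =
    disjoint-partition λ x x∈S x∈y → y∉S (subst (_∈ S) (x∈⁅y⁆⇒x≡y y x∈y) x∈S)

  size-insert : y ∉ S → ∣ S ∪ ⁅ y ⁆ ∣ ≡ suc ∣ S ∣
  size-insert {y = y} {S = S} y∉S =
    trans (partition-size (insert-partition y∉S)) (trans (cong (∣ S ∣ +_) (∣⁅x⁆∣≡1 y)) (+-comm ∣ S ∣ 1))

  size≡1⇒singleton : ∣ C ∣ ≡ 1 → Σ (Fin n) (λ x → C ≡ ⁅ x ⁆)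
  size≡1⇒singleton {C = C} e with size≡suc⇒nonempty e
  ... | x , m = x , partition-∅ (subst (Partition C ⁅ x ⁆) C-x≡∅ (single-partition m))
    where
    C-x≡∅ : C - x ≡ ∅
    C-x≡∅ = size≡0⇒≡∅ (suc-injective (trans (sym (size-remove m)) e))

  remove-insert : y ∈ S → (S - y) ∪ ⁅ y ⁆ ≡ S
  remove-insert {y = y} {S = S} y∈S = ⊆-antisym sub sup
    where
    sub : (S - y) ∪ ⁅ y ⁆ ⊆ S
    sub m with x∈p∪q⁻ (S - y) ⁅ y ⁆ m
    ... | inj₁ a = p─q⊆p S ⁅ y ⁆ a
    ... | inj₂ b = subst (_∈ S) (sym (x∈⁅y⁆⇒x≡y y b)) y∈S
    sup : S ⊆ (S - y) ∪ ⁅ y ⁆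
    sup {z} m with z ≟ y
    ... | yes refl = x∈p∪q⁺ (inj₂ (x∈⁅x⁆ y))
    ... | no z≢y  = x∈p∪q⁺ (inj₁ (x∈p∧x≢y⇒x∈p-y m z≢y))

  insert-remove : y ∉ S → (S ∪ ⁅ y ⁆) - y ≡ S
  insert-remove {y = y} {S = S} y∉S = ⊆-antisym sub sup
    where
    sub : (S ∪ ⁅ y ⁆) - y ⊆ S
    sub a with x∈p∪q⁻ S ⁅ y ⁆ (p─q⊆p _ ⁅ y ⁆ a)
    ... | inj₁ b = b
    ... | inj₂ b = ⊥-elim (∈-⇒≢ a (x∈⁅y⁆⇒x≡y y b))
    sup : S ⊆ (S ∪ ⁅ y ⁆) - y
    sup a = x∈p∧x≢y⇒x∈p-y (x∈p∪q⁺ (inj₁ a)) λ { refl → y∉S a }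

  _⊕_ : Subset n → Subset n → Subset n
  _⊕_ = zipWith _xor_

  ⊕-⊆ : C ⊆ A → D ⊆ A → C ⊕ D ⊆ A
  ⊕-⊆ {C = true ∷ C}  {D = false ∷ D} c d here = c here
  ⊕-⊆ {C = false ∷ C} {D = true ∷ D}  c d here = d here
  ⊕-⊆ {C = _ ∷ C} {A = _ ∷ A} {D = _ ∷ D} c d (there m) = there (⊕-⊆ (drop-∷-⊆ c) (drop-∷-⊆ d) m)

  ⊕≡∅⇒≡ : C ⊕ D ≡ ∅ → C ≡ D
  ⊕≡∅⇒≡ {C = []}        {D = []}        _ = refl
  ⊕≡∅⇒≡ {C = true ∷ C}  {D = true ∷ D}  e = cong (true ∷_) (⊕≡∅⇒≡ (∷-injectiveʳ e))
  ⊕≡∅⇒≡ {C = false ∷ C} {D = false ∷ D} e = cong (false ∷_) (⊕≡∅⇒≡ (∷-injectiveʳ e))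
  ⊕≡∅⇒≡ {C = true ∷ C}  {D = false ∷ D} ()
  ⊕≡∅⇒≡ {C = false ∷ C} {D = true ∷ D}  ()

  count-members : (S : Subset n) → CountIs (_∈ S) ∣ S ∣
  count-members []          = count-none (λ ())
  count-members (true ∷ S)  = count-Fin-cons-yes here (count-⇔ (λ _ → there) (λ _ → drop-there) (count-members S))
  count-members (false ∷ S) = count-Fin-cons-no (λ ()) (count-⇔ (λ _ → there) (λ _ → drop-there) (count-members S))

  count-subsets : (A : Subset n) → CountIs (_⊆ A) (2 ^ ∣ A ∣)
  count-subsets [] = (λ _ → []) , (λ { {zero} {zero} _ → refl }) , (λ _ ()) , λ { [] _ → zero , refl }
  count-subsets (true ∷ A) =
    subst (CountIs _) (cong (2 ^ ∣ A ∣ +_) (sym (+-identityʳ _)))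
      (count-Subset-cons (count-⇔ (λ _ → in⊆in) (λ _ → drop-∷-⊆) (count-subsets A))
                         (count-⇔ (λ _ → out⊆) (λ _ → drop-∷-⊆) (count-subsets A)))
  count-subsets (false ∷ A) =
    count-Subset-cons (count-none λ C s → zero∉ (s here))
                      (count-⇔ (λ _ → out⊆) (λ _ → drop-∷-⊆) (count-subsets A))
    where zero∉ : zero ∉ false ∷ A
          zero∉ ()

  _≟ₛ_ : (C D : Subset n) → Dec (C ≡ D)
  _≟ₛ_ = ≡-dec Bool._≟_

  allSubsets? : {P : Subset n → Set} → (∀ C → Dec (P C)) → Dec (∀ C → P C)
  allSubsets? {P = P} P? with anySubset? (λ C → ¬? (P? C))
  ... | yes (C , ¬p) = no λ all → ¬p (all C)
  ... | no ¬∃       = yes λ C → decidable-stable (P? C) λ ¬p → ¬∃ (C , ¬p)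

module FieldBasics {q : ℕ} (F : FiniteField q) where
  open import Level using (0ℓ)
  open import Algebra.Bundles using (CommutativeRing)
  open import Data.Nat.Properties using (even≢odd)
  open import Data.Fin using (_≟_)
  open import Data.Product using (Σ; proj₁; proj₂)
  open import Data.Empty using (⊥-elim)
  open import Relation.Nullary using (Dec; yes; no)
  open import Relation.Binary.PropositionalEquality using (sym; trans; cong; cong₂; module ≡-Reasoning)
  open FiniteField F renaming (_*_ to _·_)

  commutativeRing : CommutativeRing 0ℓ 0ℓ
  commutativeRing = record
    { Carrier = Carrier ; _≈_ = _≡_ ; _+_ = _+_ ; _*_ = _·_ ; -_ = -_ ; 0# = 0# ; 1# = 1#
    ; isCommutativeRing = isCommutativeRing }

  open CommutativeRing commutativeRing public
    using (+-assoc; +-comm; +-identityˡ; +-identityʳ; -‿inverseʳ; distribʳ; *-identityˡ; *-comm; *-assoc; zeroˡ; zeroʳ;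
           +-commutativeSemigroup)
  open import Algebra.Properties.Ring (CommutativeRing.ring commutativeRing) using (-‿involutive; -0#≈0#)

  to : Fin q → Carrier
  to = Inverse.to enum

  from : Carrier → Fin q
  from = Inverse.from enum

  to-from : ∀ x → to (from x) ≡ x
  to-from = Inverse.strictlyInverseˡ enum

  from-to : ∀ i → from (to i) ≡ i
  from-to = Inverse.strictlyInverseʳ enum

  to-injective : ∀ {i j} → to i ≡ to j → i ≡ j
  to-injective {i} {j} e = trans (sym (from-to i)) (trans (cong from e) (from-to j))

  from≡⇒≡to : ∀ {x i} → from x ≡ i → x ≡ to i
  from≡⇒≡to e = trans (sym (to-from _)) (cong to e)

  from-injective : ∀ {x y} → from x ≡ from y → x ≡ y
  from-injective {x} {y} e = trans (sym (to-from x)) (trans (cong to e) (to-from y))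

  _≟ᶠ_ : (x y : Carrier) → Dec (x ≡ y)
  x ≟ᶠ y with from x ≟ from y
  ... | yes e = yes (from-injective e)
  ... | no ¬e = no λ e → ¬e (cong from e)

  -x≡x⇒x≡0 : ¬ (1# + 1# ≡ 0#) → ∀ x → - x ≡ x → x ≡ 0#
  -x≡x⇒x≡0 2≢0 x -x≡x = begin
    x                      ≡⟨ sym (*-identityˡ x) ⟩
    1# · x                 ≡⟨ cong (_· x) (sym (trans (*-comm ½ (1# + 1#)) ½-inverse)) ⟩
    (½ · (1# + 1#)) · x    ≡⟨ *-assoc ½ _ x ⟩
    ½ · ((1# + 1#) · x)    ≡⟨ cong (½ ·_) 2x≡0 ⟩
    ½ · 0#                 ≡⟨ zeroʳ ½ ⟩
    0#                     ∎
    where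
    open ≡-Reasoning
    ½ : Carrier
    ½ = proj₁ (inverse _ 2≢0)
    ½-inverse : (1# + 1#) · ½ ≡ 1#
    ½-inverse = proj₂ (inverse _ 2≢0)
    2x≡0 : (1# + 1#) · x ≡ 0#
    2x≡0 = begin
      (1# + 1#) · x        ≡⟨ distribʳ x 1# 1# ⟩
      1# · x + 1# · x      ≡⟨ cong₂ _+_ (*-identityˡ x) (*-identityˡ x) ⟩
      x + x                ≡⟨ cong (x +_) (sym -x≡x) ⟩
      x + - x              ≡⟨ -‿inverseʳ x ⟩
      0#                   ∎

  CharacteristicTwo : Set
  CharacteristicTwo = 1# + 1# ≡ 0#

  -- In a field of even order 1 + 1 = 0: otherwise negation, read as an
  -- involution of Fin q, would have 0 as its only fixed point and q would be odd.
  characteristic-two : Σ ℕ (λ k → q ≡ 2 * k) → CharacteristicTwo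
  characteristic-two (k , q≡2k) with (1# + 1#) ≟ᶠ 0#
  ... | yes 2≡0 = 2≡0
  ... | no 2≢0 =
    let (a , q≡1+2a) = involution-odd σ σσ (from 0#) σ0 fixed in
    ⊥-elim (even≢odd k a (trans (sym q≡2k) q≡1+2a))
    where
    open Counting
    σ : Fin q → Fin q
    σ i = from (- to i)
    σσ : ∀ i → σ (σ i) ≡ i
    σσ i = to-injective (trans (to-from _) (trans (cong -_ (to-from _)) (-‿involutive (to i))))
    σ0 : σ (from 0#) ≡ from 0#
    σ0 = cong from (trans (cong -_ (to-from 0#)) -0#≈0#)
    fixed : ∀ i → σ i ≡ i → i ≡ from 0#
    fixed i e = trans (sym (from-to i)) (cong from (-x≡x⇒x≡0 2≢0 (to i) (from≡⇒≡to e)))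

module Arithmetic where
  open import Data.Nat using (NonZero)
  open import Data.Nat.DivMod using (m*n/n≡m)
  open import Data.Nat.Tactic.RingSolver using (solve-∀)
  open import Relation.Binary.PropositionalEquality using (refl)

  divide-out : ∀ {N P} d .{{_ : NonZero d}} → N * d ≡ P → P / d ≡ N
  divide-out {N} d refl = m*n/n≡m N d

  720≡120·6 : ∀ N → N * 720 ≡ 120 * (N * 6)
  720≡120·6 = solve-∀

  120≡24·5 : ∀ N → N * 120 ≡ 24 * (N * 5)
  120≡24·5 = solve-∀

  right-nested₅ : ∀ a b c d e → a * (b * (c * (d * (e * 1)))) ≡ a * b * c * d * e
  right-nested₅ = solve-∀

  right-nested₄ : ∀ a b c d → a * (b * (c * (d * 1))) ≡ a * b * c * d
  right-nested₄ = solve-∀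

module Independence {q : ℕ} (F : FiniteField q) (char-two : FieldBasics.CharacteristicTwo F) where
  open Counting
  open Subsets
  open FieldBasics F
  open FiniteField F using (Carrier; _+_; 0#; 1#)
  open import Algebra.Properties.CommutativeSemigroup +-commutativeSemigroup using (x∙yz≈y∙xz; interchange)
  open import Data.Nat using (zero; suc; _!)
  open import Data.Nat.Properties using (*-cancelˡ-≡; _!≢0)
  open import Data.Nat.Tactic.RingSolver using (solve-∀)
  open import Data.Fin using (zero; suc)
  open import Data.Fin.Subset using (_∉_; _⊆_; ∣_∣; ⁅_⁆; _∪_; _-_) renaming (⊥ to ∅)
  open import Data.Fin.Subset.Properties
    using (_∈?_; _⊆?_; anySubset?; x∈⁅x⁆; x∈⁅y⁆⇒x≡y; x∈p∪q⁻; x∈p∪q⁺; p─q⊆p; ∣⊥∣≡0; ∪-identityʳ)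
  open import Data.Fin.Properties using (all?)
  open import Data.Vec using ([]; _∷_)
  open import Function.Base using (_∘_)
  open import Data.Bool using (true; false)
  open import Data.Product using (Σ; proj₁; proj₂)
  open import Data.Sum using (inj₁; inj₂)
  open import Data.Unit using (tt)
  open import Data.Empty using (⊥-elim)
  open import Relation.Nullary using (Dec; yes; no; ¬?)
  open import Relation.Nullary.Decidable using (_×-dec_; _→-dec_)
  open import Relation.Binary.PropositionalEquality using (refl; sym; trans; cong; cong₂; subst; module ≡-Reasoning)
  import Data.Nat.Properties as ℕ
  import Data.Fin as Fin

  private variable
    n : ℕ

  x+x≡0 : ∀ x → x + x ≡ 0#
  x+x≡0 x = begin
    x + x              ≡⟨ cong₂ _+_ (sym (*-identityˡ x)) (sym (*-identityˡ x)) ⟩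
    1# · x + 1# · x    ≡⟨ sym (distribʳ x 1# 1#) ⟩
    (1# + 1#) · x      ≡⟨ cong (_· x) char-two ⟩
    0# · x             ≡⟨ zeroˡ x ⟩
    0#                 ∎
    where open ≡-Reasoning
          open FiniteField F using () renaming (_*_ to _·_)

  move : ∀ {a b c} → a + b ≡ c → a ≡ c + b
  move {a} {b} {c} e = begin
    a              ≡⟨ sym (+-identityʳ a) ⟩
    a + 0#         ≡⟨ cong (a +_) (sym (x+x≡0 b)) ⟩
    a + (b + b)    ≡⟨ sym (+-assoc a b b) ⟩
    (a + b) + b    ≡⟨ cong (_+ b) e ⟩
    c + b          ∎
    where open ≡-Reasoning

  sum≡0⇒≡ : ∀ {a b} → a + b ≡ 0# → a ≡ b
  sum≡0⇒≡ e = trans (move e) (+-identityˡ _)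

  sum-partition : (f : Fin n → Carrier) {B C D : Subset n} → Partition B C D
    → sumOver F f B ≡ sumOver F f C + sumOver F f D
  sum-partition f []      = sym (+-identityʳ 0#)
  sum-partition f (inˡ p) = trans (cong (f zero +_) (sum-partition (f ∘ suc) p)) (sym (+-assoc _ _ _))
  sum-partition f (inʳ p) = trans (cong (f zero +_) (sum-partition (f ∘ suc) p)) (x∙yz≈y∙xz _ _ _)
  sum-partition f (out p) = sum-partition (f ∘ suc) p

  sum-∅ : (f : Fin n → Carrier) → sumOver F f ∅ ≡ 0#
  sum-∅ {zero}  f = refl
  sum-∅ {suc n} f = sum-∅ (f ∘ suc)

  sum-singleton : (f : Fin n → Carrier) (i : Fin n) → sumOver F f ⁅ i ⁆ ≡ f i
  sum-singleton f zero    = trans (cong (f zero +_) (sum-∅ (f ∘ suc))) (+-identityʳ _)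
  sum-singleton f (suc i) = sum-singleton (f ∘ suc) i

  -- Over a symmetric difference the common elements cancel in pairs.
  sum-⊕ : (f : Fin n → Carrier) (C D : Subset n) → sumOver F f (C ⊕ D) ≡ sumOver F f C + sumOver F f D
  sum-⊕ f [] [] = sym (+-identityʳ 0#)
  sum-⊕ {suc n} f (true ∷ C) (true ∷ D) = begin
    Σ′ (C ⊕ D)                        ≡⟨ sum-⊕ (f ∘ suc) C D ⟩
    Σ′ C + Σ′ D                       ≡⟨ sym (+-identityˡ _) ⟩
    0# + (Σ′ C + Σ′ D)                ≡⟨ cong (_+ (Σ′ C + Σ′ D)) (sym (x+x≡0 (f zero))) ⟩
    (f zero + f zero) + (Σ′ C + Σ′ D) ≡⟨ interchange _ _ _ _ ⟩
    (f zero + Σ′ C) + (f zero + Σ′ D) ∎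
    where open ≡-Reasoning
          Σ′ : Subset n → Carrier
          Σ′ = sumOver F (f ∘ suc)
  sum-⊕ f (true ∷ C)  (false ∷ D) = trans (cong (f zero +_) (sum-⊕ (f ∘ suc) C D)) (sym (+-assoc _ _ _))
  sum-⊕ f (false ∷ C) (true ∷ D)  = trans (cong (f zero +_) (sum-⊕ (f ∘ suc) C D)) (x∙yz≈y∙xz _ _ _)
  sum-⊕ f (false ∷ C) (false ∷ D) = sum-⊕ (f ∘ suc) C D

  ∑ : Subset q → Carrier
  ∑ = elemSum F

  ∑-singleton : ∀ i → ∑ ⁅ i ⁆ ≡ to i
  ∑-singleton = sum-singleton to

  Independent : Subset q → Set
  Independent T = ∀ C → C ⊆ T → ∑ C ≡ 0# → C ≡ ∅

  independent-⊆ : ∀ {T T'} → T' ⊆ T → Independent T → Independent T'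
  independent-⊆ T'⊆T ind C C⊆T' = ind C (T'⊆T ∘ C⊆T')

  independent? : ∀ T → Dec (Independent T)
  independent? T = allSubsets? λ C → (C ⊆? T) →-dec ((∑ C ≟ᶠ 0#) →-dec (C ≟ₛ ∅))

  independent-∅ : Independent ∅
  independent-∅ C C⊆∅ _ = ⊆∅⇒≡∅ C⊆∅

  independent-injective : ∀ {A C D} → Independent A → C ⊆ A → D ⊆ A → ∑ C ≡ ∑ D → C ≡ D
  independent-injective {C = C} {D} ind C⊆A D⊆A e =
    ⊕≡∅⇒≡ (ind (C ⊕ D) (⊕-⊆ C⊆A D⊆A) (trans (sum-⊕ to C D) (trans (cong (_+ ∑ D) e) (x+x≡0 _))))

  Spans : Subset q → Fin q → Set
  Spans A y = Σ (Subset q) λ C → C ⊆ A × from (∑ C) ≡ y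

  spans? : ∀ A y → Dec (Spans A y)
  spans? A y = anySubset? λ C → (C ⊆? A) ×-dec (from (∑ C) Fin.≟ y)

  count-span : ∀ {A} → Independent A → CountIs (Spans A) (2 ^ ∣ A ∣)
  count-span {A} ind =
    count-image {P = _⊆ A} (λ C → from (∑ C)) (λ C D c d e → independent-injective ind c d (from-injective e)) (count-subsets A)

  Extends : Subset q → Fin q → Set
  Extends A y = y ∉ A × Independent (A ∪ ⁅ y ⁆)

  ∑-insert : ∀ {S : Subset q} {y} → y ∉ S → ∑ (S ∪ ⁅ y ⁆) ≡ ∑ S + to y
  ∑-insert {S} {y} y∉S = trans (sum-partition to (insert-partition y∉S)) (cong (∑ S +_) (∑-singleton y))

  ∑-remove : ∀ {S : Subset q} {y} → y ∈ S → ∑ S ≡ to y + ∑ (S - y)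
  ∑-remove {S} {y} y∈S = trans (sum-partition to (single-partition y∈S)) (cong (_+ ∑ (S - y)) (∑-singleton y))

  -- y extends A exactly when A does not span y: a subset of A summing to y would
  -- give the nonempty zero-sum subset C ∪ ⁅ y ⁆, and conversely.
  extends⇒¬spans : ∀ {A : Subset q} {y} → Extends A y → ¬ Spans A y
  extends⇒¬spans {A} {y} (y∉A , ind) (C , C⊆A , e) = ∉∅ (subst (y ∈_) C∪y≡∅ (x∈p∪q⁺ (inj₂ (x∈⁅x⁆ y))))
    where
    y∉C : y ∉ C
    y∉C y∈C = y∉A (C⊆A y∈C)
    C∪y⊆A∪y : C ∪ ⁅ y ⁆ ⊆ A ∪ ⁅ y ⁆
    C∪y⊆A∪y m with x∈p∪q⁻ C ⁅ y ⁆ m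
    ... | inj₁ a = x∈p∪q⁺ (inj₁ (C⊆A a))
    ... | inj₂ b = x∈p∪q⁺ (inj₂ b)
    C∪y≡∅ : C ∪ ⁅ y ⁆ ≡ ∅
    C∪y≡∅ = ind _ C∪y⊆A∪y
      (trans (∑-insert y∉C) (trans (cong (_+ to y) (from≡⇒≡to e)) (x+x≡0 _)))

  ¬spans⇒extends : ∀ {A : Subset q} {y} → Independent A → ¬ Spans A y → Extends A y
  ¬spans⇒extends {A} {y} ind ¬span = y∉A , ind′
    where
    y∉A : y ∉ A
    y∉A y∈A =
      ¬span (⁅ y ⁆ , (λ m → subst (_∈ A) (sym (x∈⁅y⁆⇒x≡y y m)) y∈A) , trans (cong from (∑-singleton y)) (from-to y))
    ind′ : Independent (A ∪ ⁅ y ⁆)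
    ind′ C C⊆A∪y ∑C≡0 with y ∈? C
    ... | yes y∈C = ⊥-elim (¬span (C - y , C-y⊆A , trans (cong from (sym y≡∑)) (from-to y)))
      where
      C-y⊆A : C - y ⊆ A
      C-y⊆A {x} m with x∈p∪q⁻ A ⁅ y ⁆ (C⊆A∪y (p─q⊆p C ⁅ y ⁆ m))
      ... | inj₁ a = a
      ... | inj₂ b = ⊥-elim (∈-⇒≢ m (x∈⁅y⁆⇒x≡y y b))
      y≡∑ : to y ≡ ∑ (C - y)
      y≡∑ = sum≡0⇒≡ (trans (sym (∑-remove y∈C)) ∑C≡0)
    ... | no y∉C = ind C C⊆A ∑C≡0
      where
      C⊆A : C ⊆ A
      C⊆A {x} m with x∈p∪q⁻ A ⁅ y ⁆ (C⊆A∪y m)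
      ... | inj₁ a = a
      ... | inj₂ b = ⊥-elim (y∉C (subst (_∈ C) (x∈⁅y⁆⇒x≡y y b) m))

  count-extends : ∀ {A} → Independent A → CountIs (Extends A) (q ∸ 2 ^ ∣ A ∣)
  count-extends {A} ind =
    count-⇔ (λ y p → ¬spans⇒extends ind (proj₂ p)) (λ y e → tt , extends⇒¬spans e)
      (count-complement count-everything (spans? A) (count-⇔ (λ y s → tt , s) (λ y → proj₂) (count-span ind)))

  Disjoint : Subset q → Subset q → Set
  Disjoint A S = ∀ x → x ∈ A → x ∉ S

  Extension : Subset q → ℕ → Subset q → Set
  Extension A k S = Disjoint A S × ∣ S ∣ ≡ k × Independent (A ∪ S)

  extension? : ∀ A k S → Dec (Extension A k S)
  extension? A k S =
    all? (λ x → (x ∈? A) →-dec ¬? (x ∈? S)) ×-dec (∣ S ∣ ℕ.≟ k) ×-dec independent? (A ∪ S)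

  extension-remove : ∀ {A k S y} → Extension A (suc k) S → y ∈ S
    → Extends A y × Extension (A ∪ ⁅ y ⁆) k (S - y)
  extension-remove {A} {k} {S} {y} (disj , size , ind) y∈S =
    ((λ y∈A → disj y y∈A y∈S) , independent-⊆ A∪y⊆A∪S ind) ,
    disj′ , ℕ.suc-injective (trans (sym (size-remove y∈S)) size) , independent-⊆ sub ind
    where
    A∪y⊆A∪S : A ∪ ⁅ y ⁆ ⊆ A ∪ S
    A∪y⊆A∪S m with x∈p∪q⁻ A ⁅ y ⁆ m
    ... | inj₁ a = x∈p∪q⁺ (inj₁ a)
    ... | inj₂ b = x∈p∪q⁺ (inj₂ (subst (_∈ S) (sym (x∈⁅y⁆⇒x≡y y b)) y∈S))
    disj′ : Disjoint (A ∪ ⁅ y ⁆) (S - y)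
    disj′ x m m′ with x∈p∪q⁻ A ⁅ y ⁆ m
    ... | inj₁ a = disj x a (p─q⊆p S ⁅ y ⁆ m′)
    ... | inj₂ b = ∈-⇒≢ m′ (x∈⁅y⁆⇒x≡y y b)
    sub : (A ∪ ⁅ y ⁆) ∪ (S - y) ⊆ A ∪ S
    sub m with x∈p∪q⁻ (A ∪ ⁅ y ⁆) (S - y) m
    ... | inj₁ a = A∪y⊆A∪S a
    ... | inj₂ b = x∈p∪q⁺ (inj₂ (p─q⊆p S ⁅ y ⁆ b))

  extension-∉ : ∀ {A k S y} → Extension (A ∪ ⁅ y ⁆) k S → y ∉ S
  extension-∉ {y = y} (disj , _) = disj y (x∈p∪q⁺ (inj₂ (x∈⁅x⁆ y)))

  extension-insert : ∀ {A k S y} → Extends A y → Extension (A ∪ ⁅ y ⁆) k S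
    → Extension A (suc k) (S ∪ ⁅ y ⁆)
  extension-insert {A} {k} {S} {y} (y∉A , _) ext@(disj , size , ind) =
    disj′ , trans (size-insert (extension-∉ ext)) (cong suc size) , independent-⊆ sub ind
    where
    disj′ : Disjoint A (S ∪ ⁅ y ⁆)
    disj′ x x∈A m with x∈p∪q⁻ S ⁅ y ⁆ m
    ... | inj₁ a = disj x (x∈p∪q⁺ (inj₁ x∈A)) a
    ... | inj₂ b = y∉A (subst (_∈ A) (x∈⁅y⁆⇒x≡y y b) x∈A)
    sub : A ∪ (S ∪ ⁅ y ⁆) ⊆ (A ∪ ⁅ y ⁆) ∪ S
    sub m with x∈p∪q⁻ A (S ∪ ⁅ y ⁆) m
    ... | inj₁ a = x∈p∪q⁺ (inj₁ (x∈p∪q⁺ (inj₁ a)))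
    ... | inj₂ b with x∈p∪q⁻ S ⁅ y ⁆ b
    ... | inj₁ c = x∈p∪q⁺ (inj₂ c)
    ... | inj₂ c = x∈p∪q⁺ (inj₁ (x∈p∪q⁺ (inj₂ c)))

  count-extensions-through : ∀ {A k y N} → Extends A y → CountIs (λ S → Extension A (suc k) S × y ∈ S) N
    → CountIs (Extension (A ∪ ⁅ y ⁆) k) N
  count-extensions-through {y = y} ext =
    count-bijection (_- y) (_∪ ⁅ y ⁆)
      (λ S (e , y∈S) → proj₂ (extension-remove e y∈S)) (λ S e → extension-insert ext e , x∈p∪q⁺ (inj₂ (x∈⁅x⁆ y)))
      (λ S (_ , y∈S) → remove-insert y∈S) (λ S e → insert-remove (extension-∉ e))

  gaps : ℕ → ℕ → ℕ
  gaps a zero    = 1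
  gaps a (suc k) = (q ∸ 2 ^ a) * gaps (suc a) k

  uniform-fibres : ∀ k {A c} → Independent A
    → (∀ y → Extends A y → ∀ {K} → CountIs (Extension (A ∪ ⁅ y ⁆) k) K → k ! * K ≡ gaps (suc ∣ A ∣) k)
    → CountIs (Extends A) c
    → Σ ℕ λ K → (∀ y → Extends A y → CountIs (Extension (A ∪ ⁅ y ⁆) k) K) × c * (k ! * K) ≡ c * gaps (suc ∣ A ∣) k
  uniform-fibres k {c = zero} _ _ none = 0 , (λ y e → ⊥-elim (count-zero⇒none none y e)) , refl
  uniform-fibres k {A} {c = suc c} _ size C@(f , _ , fExt , _) =
    K₀ , fibre , cong (suc c *_) (size y₀ (fExt zero) C₀)
    where
    count-fibre : ∀ y → Σ ℕ (CountIs (Extension (A ∪ ⁅ y ⁆) k))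
    count-fibre y = count-Subset _ (extension? (A ∪ ⁅ y ⁆) k)
    y₀ : Fin q
    y₀ = f zero
    K₀ : ℕ
    K₀ = proj₁ (count-fibre y₀)
    C₀ : CountIs (Extension (A ∪ ⁅ y₀ ⁆) k) K₀
    C₀ = proj₂ (count-fibre y₀)
    fibre : ∀ y → Extends A y → CountIs (Extension (A ∪ ⁅ y ⁆) k) K₀
    fibre y e = let (K , C′) = count-fibre y in
      subst (CountIs _) (*-cancelˡ-≡ K K₀ (k !) {{k !≢0}} (trans (size y e C′) (sym (size y₀ (fExt zero) C₀)))) C′

  rearrange₁ : ∀ s f N → s * f * N ≡ f * (N * s)
  rearrange₁ = solve-∀

  rearrange₂ : ∀ f c K → f * (c * K) ≡ c * (f * K)
  rearrange₂ = solve-∀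

  -- Pairs (S , y) with y ∈ S are counted twice:
  -- as N · (k+1), and as (q - 2^∣A∣) choices of y times the k-extensions
  -- of A ∪ ⁅ y ⁆.
  count-extensions : ∀ k {A N} → Independent A → CountIs (Extension A k) N → k ! * N ≡ gaps ∣ A ∣ k
  count-extensions zero {A} {N} ind C =
    trans (ℕ.*-identityˡ N)
      (count-unique C (count-⇔ (λ { S refl → empty }) (λ S e → size≡0⇒≡∅ (proj₁ (proj₂ e))) (count-singleton ∅)))
    where
    empty : Extension A 0 ∅
    empty = (λ _ _ → ∉∅) , ∣⊥∣≡0 q , subst Independent (sym (∪-identityʳ A)) ind
  count-extensions (suc k) {A} {N} ind C
    with uniform-fibres k ind
           (λ y (y∉A , ind′) C′ → trans (count-extensions k ind′ C′) (cong (λ a → gaps a k) (size-insert y∉A)))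
           (count-extends ind)
  ... | K , fibre , fibre-size = begin
    suc k * k ! * N          ≡⟨ rearrange₁ (suc k) (k !) N ⟩
    k ! * (N * suc k)        ≡⟨ cong (k ! *_) (count-unique by-set by-element) ⟩
    k ! * (c * K)            ≡⟨ rearrange₂ (k !) c K ⟩
    c * (k ! * K)            ≡⟨ fibre-size ⟩
    c * gaps (suc ∣ A ∣) k   ∎
    where
    open ≡-Reasoning
    c : ℕ
    c = q ∸ 2 ^ ∣ A ∣
    Pair : Fin q × Subset q → Set
    Pair (y , S) = Extends A y × Extension (A ∪ ⁅ y ⁆) k S
    by-element : CountIs Pair (c * K)
    by-element = count-pairs (count-extends ind) fibre
    by-set : CountIs Pair (N * suc k)
    by-set = count-bijection (λ (S , y) → y , S - y) (λ (y , S) → S ∪ ⁅ y ⁆ , y)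
      (λ (S , y) (e , y∈S) → extension-remove e y∈S)
      (λ (y , S) (ext , e) → extension-insert ext e , x∈p∪q⁺ (inj₂ (x∈⁅x⁆ y)))
      (λ (S , y) (_ , y∈S) → cong (_, y) (remove-insert y∈S))
      (λ (y , S) (_ , e) → cong (y ,_) (insert-remove (extension-∉ e)))
      (count-pairs C (λ S e → subst (CountIs _) (proj₁ (proj₂ e)) (count-members S)))

module Blocks {q : ℕ} (F : FiniteField q) (char-two : FieldBasics.CharacteristicTwo F) where
  open Counting
  open Subsets
  open FieldBasics F
  open Independence F char-two
  open Arithmetic
  open import Algebra.Properties.CommutativeSemigroup +-commutativeSemigroup using (x∙yz≈y∙xz)
  open FiniteField F using (_+_; 0#; 1#; 0≢1)
  open import Data.Nat using (zero; suc; s≤s; z≤n; _!) renaming (_+_ to _+ℕ_)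
  import Data.Nat.Properties as ℕ
  open import Data.Fin.Subset using (_∉_; _⊆_; ∣_∣; ⁅_⁆; _∪_; _─_; _-_) renaming (⊥ to ∅)
  open import Data.Fin.Subset.Properties
    using (_∈?_; _⊆?_; ⊆-antisym; ∪-comm; x∈⁅x⁆; x∈⁅y⁆⇒x≡y; x∈p∪q⁻; x∈p∪q⁺; p─q⊆p; x∈p∧x≢y⇒x∈p-y;
           ∣⊥∣≡0; ∣⁅x⁆∣≡1; p⊆q⇒∣p∣≤∣q∣)
  open import Data.Product using (proj₁; proj₂)
  open import Data.Sum using (_⊎_; inj₁; inj₂)
  open import Data.Unit using (⊤; tt)
  open import Data.Empty using (⊥; ⊥-elim)
  open import Relation.Nullary using (Dec; yes; no; ¬?)
  open import Relation.Nullary.Decidable using (_×-dec_; _→-dec_)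
  open import Relation.Binary.PropositionalEquality using (refl; sym; trans; cong; cong₂; subst; module ≡-Reasoning)
  open import Function.Base using (_∘_)

  one : Fin q
  one = from 1#

  to-one : to one ≡ 1#
  to-one = to-from 1#

  Clean : Subset q → Set
  Clean D = ¬ ∑ D ≡ 0# × ¬ ∑ D ≡ 1#

  AllClean : Subset q → Set
  AllClean S = ∀ E → E ⊆ S → 1 ≤ ∣ E ∣ → Clean E

  -- The description of W₆ used for counting.
  Block : Subset q → Set
  Block B = ∣ B ∣ ≡ 6 × ∑ B ≡ 1# × (∀ D → D ⊆ B → 1 ≤ ∣ D ∣ → ∣ D ∣ ≤ 5 → Clean D)

  block? : ∀ B → Dec (Block B)
  block? B = (∣ B ∣ ℕ.≟ 6) ×-dec (∑ B ≟ᶠ 1#) ×-dec allSubsets? λ D →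
    (D ⊆? B) →-dec ((1 ℕ.≤? ∣ D ∣) →-dec ((∣ D ∣ ℕ.≤? 5) →-dec (¬? (∑ D ≟ᶠ 0#) ×-dec ¬? (∑ D ≟ᶠ 1#))))

  ∅-or-nonempty : ∀ (C : Subset q) → C ≡ ∅ ⊎ 1 ≤ ∣ C ∣
  ∅-or-nonempty C with ∣ C ∣ in eq
  ... | zero  = inj₁ (size≡0⇒≡∅ eq)
  ... | suc _ = inj₂ (s≤s z≤n)

  ∑-∅ : ∑ ∅ ≡ 0#
  ∑-∅ = sum-∅ to

  -- {1} ∪ S is independent exactly when every nonempty subset of S is clean.
  -- No subset of S sums to 1, since 1 ∉ S extends S.
  independent-with-one⇒sum≢1 : ∀ {S E : Subset q} → one ∉ S → Independent (⁅ one ⁆ ∪ S) → E ⊆ S → ¬ ∑ E ≡ 1#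
  independent-with-one⇒sum≢1 {S} {E} one∉S ind E⊆S ∑E≡1 =
    extends⇒¬spans (one∉S , subst Independent (∪-comm ⁅ one ⁆ S) ind) (E , E⊆S , cong from ∑E≡1)

  independent-with-one⇒clean : ∀ {S : Subset q} → one ∉ S → Independent (⁅ one ⁆ ∪ S) → AllClean S
  independent-with-one⇒clean {S} one∉S ind E E⊆S 1≤∣E∣ =
    (λ ∑E≡0 → nonempty⇒≢∅ 1≤∣E∣ (ind E (λ m → x∈p∪q⁺ (inj₂ (E⊆S m))) ∑E≡0)) ,
    independent-with-one⇒sum≢1 one∉S ind E⊆S

  -- Conversely, a zero-sum subset C of {1} ∪ S either contains 1, and then
  -- C - 1 sums to 1, or lies in S.
  clean⇒independent-with-one : ∀ {S : Subset q} → AllClean S → Independent (⁅ one ⁆ ∪ S)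
  clean⇒independent-with-one {S} clean C C⊆ ∑C≡0 with one ∈? C
  ... | yes one∈C = ⊥-elim (no-sum-one (∅-or-nonempty (C - one)))
    where
    C-one⊆S : C - one ⊆ S
    C-one⊆S m with x∈p∪q⁻ ⁅ one ⁆ S (C⊆ (p─q⊆p C ⁅ one ⁆ m))
    ... | inj₁ a = ⊥-elim (∈-⇒≢ m (x∈⁅y⁆⇒x≡y one a))
    ... | inj₂ b = b
    ∑≡1 : ∑ (C - one) ≡ 1#
    ∑≡1 = trans (sym (sum≡0⇒≡ (trans (sym (∑-remove one∈C)) ∑C≡0))) to-one
    no-sum-one : C - one ≡ ∅ ⊎ 1 ≤ ∣ C - one ∣ → ⊥
    no-sum-one (inj₁ ≡∅)  = 0≢1 (trans (sym ∑-∅) (trans (cong ∑ (sym ≡∅)) ∑≡1))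
    no-sum-one (inj₂ 1≤∣∣) = proj₂ (clean _ C-one⊆S 1≤∣∣) ∑≡1
  ... | no one∉C with ∅-or-nonempty C
  ...   | inj₁ ≡∅   = ≡∅
  ...   | inj₂ 1≤∣C∣ = ⊥-elim (proj₁ (clean C C⊆S 1≤∣C∣) ∑C≡0)
    where
    C⊆S : C ⊆ S
    C⊆S m with x∈p∪q⁻ ⁅ one ⁆ S (C⊆ m)
    ... | inj₁ a = ⊥-elim (one∉C (subst (_∈ C) (x∈⁅y⁆⇒x≡y one a) m))
    ... | inj₂ b = b

  ∑-complement : ∀ {B D : Subset q} → ∑ B ≡ 1# → D ⊆ B → ∑ (B ─ D) ≡ 1# + ∑ D
  ∑-complement {B} {D} ∑B≡1 D⊆B =
    trans (move (trans (+-comm _ _) (sym (sum-partition to (⊆-partition D⊆B))))) (cong (_+ ∑ D) ∑B≡1)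

  clean-complement : ∀ {B D : Subset q} → ∑ B ≡ 1# → D ⊆ B → Clean (B ─ D) → Clean D
  clean-complement {B} {D} ∑B≡1 D⊆B (≢0 , ≢1) =
    (λ ∑D≡0 → ≢1 (trans (∑-complement ∑B≡1 D⊆B) (trans (cong (1# +_) ∑D≡0) (+-identityʳ 1#)))) ,
    (λ ∑D≡1 → ≢0 (trans (∑-complement ∑B≡1 D⊆B) (trans (cong (1# +_) ∑D≡1) char-two)))

  size-6-remove : ∀ {B : Subset q} {y} → ∣ B ∣ ≡ 6 → y ∈ B → ∣ B - y ∣ ≡ 5
  size-6-remove size y∈B = ℕ.suc-injective (trans (sym (size-remove y∈B)) size)

  block⇒clean : ∀ {B : Subset q} {y} → Block B → y ∈ B → AllClean (B - y)
  block⇒clean {B} {y} (size , _ , clean) y∈B E E⊆ 1≤∣E∣ =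
    clean E (p─q⊆p B ⁅ y ⁆ ∘ E⊆) 1≤∣E∣ (subst (∣ E ∣ ≤_) (size-6-remove size y∈B) (p⊆q⇒∣p∣≤∣q∣ E⊆))

  -- ... and conversely, since a subset containing y has its complement in B - y.
  clean⇒block : ∀ {B : Subset q} {y} → ∣ B ∣ ≡ 6 → ∑ B ≡ 1# → y ∈ B → AllClean (B - y) → Block B
  clean⇒block {B} {y} size ∑B≡1 y∈B clean = size , ∑B≡1 , clean′
    where
    clean′ : ∀ D → D ⊆ B → 1 ≤ ∣ D ∣ → ∣ D ∣ ≤ 5 → Clean D
    clean′ D D⊆B 1≤∣D∣ ∣D∣≤5 with y ∈? D
    ... | no y∉D = clean D (λ m → x∈p∧x≢y⇒x∈p-y (D⊆B m) λ { refl → y∉D m }) 1≤∣D∣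
    ... | yes y∈D = clean-complement ∑B≡1 D⊆B (clean (B ─ D) B─D⊆ 1≤∣B─D∣)
      where
      B─D⊆ : B ─ D ⊆ B - y
      B─D⊆ m = x∈p∧x≢y⇒x∈p-y (p─q⊆p B D m) λ { refl → ∈─⇒∉ m y∈D }
      1≤∣B─D∣ : 1 ≤ ∣ B ─ D ∣
      1≤∣B─D∣ with ∅-or-nonempty (B ─ D)
      ... | inj₂ h = h
      ... | inj₁ ≡∅ = ⊥-elim (ℕ.<⇒≱ (s≤s ∣D∣≤5) (ℕ.≤-reflexive (begin
        6                       ≡⟨ sym size ⟩
        ∣ B ∣                   ≡⟨ partition-size (⊆-partition D⊆B) ⟩
        ∣ D ∣ +ℕ ∣ B ─ D ∣      ≡⟨ cong (λ E → ∣ D ∣ +ℕ ∣ E ∣) ≡∅ ⟩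
        ∣ D ∣ +ℕ ∣ ∅ {q} ∣      ≡⟨ cong (∣ D ∣ +ℕ_) (∣⊥∣≡0 q) ⟩
        ∣ D ∣ +ℕ 0              ≡⟨ ℕ.+-identityʳ _ ⟩
        ∣ D ∣                   ∎)))
        where open ≡-Reasoning

  singleton-clean : ∀ {C : Subset q} {i} → C ≡ ⁅ i ⁆ → ¬ to i ≡ 0# × ¬ to i ≡ 1# → Clean C
  singleton-clean {i = i} refl (≢0 , ≢1) =
    (λ e → ≢0 (trans (sym (∑-singleton i)) e)) , (λ e → ≢1 (trans (sym (∑-singleton i)) e))

  -- Two distinct elements never sum to 0 in characteristic two.
  pair-sum≢0 : ∀ {C : Subset q} → ∣ C ∣ ≡ 2 → ¬ ∑ C ≡ 0#
  pair-sum≢0 {C} size ∑C≡0 with size≡suc⇒nonempty {C = C} size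
  ... | i , i∈C with size≡1⇒singleton {C = C - i} (ℕ.suc-injective (trans (sym (size-remove {S = C} i∈C)) size))
  ... | j , C-i≡j = ∈-⇒≢ j∈C-i (sym (to-injective ti≡tj))
    where
    j∈C-i : j ∈ C - i
    j∈C-i = subst (j ∈_) (sym C-i≡j) (x∈⁅x⁆ j)
    ti≡tj : to i ≡ to j
    ti≡tj = sum≡0⇒≡ (trans (cong (to i +_) (sym (trans (cong ∑ C-i≡j) (∑-singleton j))))
                           (trans (sym (∑-remove {S = C} i∈C)) ∑C≡0))

  -- A subset of size ℓ ≤ 4 of X summing to 1 lies in W_ℓ (nothing smaller
  -- than ℓ - 2 needs to be excluded).
  small-in-W : ∀ {C : Subset q} {ℓ} → ℓ ≤ 4 → InX F C → ∣ C ∣ ≡ ℓ → ∑ C ≡ 1# → Wf F 5 ℓ C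
  small-in-W ℓ≤4 inX size ∑C≡1 = inX , size , ∑C≡1 , λ ℓ′ 2≤ℓ′ ℓ′+3≤ℓ _ _ _ _ →
    ℕ.≤⇒≯ (ℕ.≤-trans (ℕ.+-monoˡ-≤ 3 2≤ℓ′) (ℕ.≤-trans ℓ′+3≤ℓ ℓ≤4)) (ℕ.n<1+n 4)

  size-cases : ∀ d e → d +ℕ e ≡ 6 → 1 ≤ d → d ≤ 5 → (d ≡ 1 ⊎ d ≡ 2) ⊎ (d ≡ 3 × e ≡ 3) ⊎ (e ≡ 1 ⊎ e ≡ 2)
  size-cases 1 _ _ _ _ = inj₁ (inj₁ refl)
  size-cases 2 _ _ _ _ = inj₁ (inj₂ refl)
  size-cases 3 .3 refl _ _ = inj₂ (inj₁ (refl , refl))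
  size-cases 4 .2 refl _ _ = inj₂ (inj₂ (inj₂ refl))
  size-cases 5 .1 refl _ _ = inj₂ (inj₂ (inj₁ refl))
  size-cases (suc (suc (suc (suc (suc (suc _)))))) _ _ _ (s≤s (s≤s (s≤s (s≤s (s≤s ())))))

  -- Every block of W₆ is a Block: subsets of size 1 and 2 are clean because
  -- B ⊆ X, its elements are distinct and B contains no block of W₂; no subset of
  -- size 3 sums to 1 as B contains no block of W₃; the remaining subsets are
  -- handled through their complements.
  W⇒block : ∀ {B : Subset q} → W F 6 B → Block B
  W⇒block {B} (inX , size , ∑B≡1 , no-smaller) = size , ∑B≡1 , clean
    where
    no-sum-one : ∀ {C ℓ} → 2 ≤ ℓ → ℓ ≤ 3 → C ⊆ B → ∣ C ∣ ≡ ℓ → ¬ ∑ C ≡ 1#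
    no-sum-one {C} {ℓ} 2≤ℓ ℓ≤3 C⊆B size ∑C≡1 =
      no-smaller ℓ 2≤ℓ (ℕ.+-monoˡ-≤ 3 ℓ≤3) C C⊆B size
        (small-in-W (ℕ.m≤n⇒m≤1+n ℓ≤3) (λ i m → inX i (C⊆B m)) size ∑C≡1)
    small-clean : ∀ {C} → C ⊆ B → ∣ C ∣ ≡ 1 ⊎ ∣ C ∣ ≡ 2 → Clean C
    small-clean {C} C⊆B (inj₁ size) with size≡1⇒singleton {C = C} size
    ... | i , C≡i = singleton-clean C≡i (inX i (C⊆B (subst (i ∈_) (sym C≡i) (x∈⁅x⁆ i))))
    small-clean {C} C⊆B (inj₂ size) = pair-sum≢0 {C} size , no-sum-one (s≤s (s≤s z≤n)) (s≤s (s≤s z≤n)) C⊆B size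
    clean : ∀ D → D ⊆ B → 1 ≤ ∣ D ∣ → ∣ D ∣ ≤ 5 → Clean D
    clean D D⊆B 1≤∣D∣ ∣D∣≤5
      with size-cases ∣ D ∣ ∣ B ─ D ∣ (trans (sym (partition-size (⊆-partition D⊆B))) size) 1≤∣D∣ ∣D∣≤5
    ... | inj₁ small = small-clean D⊆B small
    ... | inj₂ (inj₁ (∣D∣≡3 , ∣B─D∣≡3)) =
      (λ ∑D≡0 → no-sum-one (s≤s (s≤s z≤n)) ℕ.≤-refl (p─q⊆p B D) ∣B─D∣≡3
                  (trans (∑-complement ∑B≡1 D⊆B) (trans (cong (1# +_) ∑D≡0) (+-identityʳ 1#)))) ,
      no-sum-one (s≤s (s≤s z≤n)) ℕ.≤-refl D⊆B ∣D∣≡3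
    ... | inj₂ (inj₂ small) = clean-complement ∑B≡1 D⊆B (small-clean (p─q⊆p B D) small)

  -- Conversely every Block lies in W₆: its clean singletons put it inside X and
  -- its clean subsets of size 2 and 3 cannot be blocks of W₂ or W₃.
  block⇒W : ∀ {B : Subset q} → Block B → W F 6 B
  block⇒W {B} (size , ∑B≡1 , clean) = inX , size , ∑B≡1 , no-smaller
    where
    inX : InX F B
    inX i i∈B =
      let (≢0 , ≢1) = clean ⁅ i ⁆ (λ m → subst (_∈ B) (sym (x∈⁅y⁆⇒x≡y i m)) i∈B)
                        (ℕ.≤-reflexive (sym (∣⁅x⁆∣≡1 i))) (ℕ.≤-trans (ℕ.≤-reflexive (∣⁅x⁆∣≡1 i)) (s≤s z≤n))
      in (λ e → ≢0 (trans (∑-singleton i) e)) , (λ e → ≢1 (trans (∑-singleton i) e))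
    no-smaller : ∀ ℓ → 2 ≤ ℓ → ℓ +ℕ 3 ≤ 6 → ∀ C → C ⊆ B → ∣ C ∣ ≡ ℓ → ¬ Wf F 5 ℓ C
    no-smaller ℓ 2≤ℓ ℓ+3≤6 C C⊆B size (_ , _ , ∑C≡1 , _) =
      proj₂ (clean C C⊆B (subst (1 ≤_) (sym size) (ℕ.≤-trans (s≤s z≤n) 2≤ℓ))
                         (subst (_≤ 5) (sym size) (ℕ.m≤n⇒m≤1+n (ℕ.m≤n⇒m≤1+n (ℕ.+-cancelʳ-≤ 3 ℓ 3 ℓ+3≤6))))) ∑C≡1

  -- A block does not contain 1, since ⁅ 1 ⁆ is not clean.
  one∉block : ∀ {B : Subset q} → Block B → one ∉ B
  one∉block {B} (_ , _ , clean) one∈B =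
    proj₂ (clean ⁅ one ⁆ (λ m → subst (_∈ B) (sym (x∈⁅y⁆⇒x≡y one m)) one∈B)
                 (ℕ.≤-reflexive (sym (∣⁅x⁆∣≡1 one))) (ℕ.≤-trans (ℕ.≤-reflexive (∣⁅x⁆∣≡1 one)) (s≤s z≤n)))
          (trans (∑-singleton one) to-one)

  block-remove : ∀ {B : Subset q} {y} → Block B → y ∈ B → Extension ⁅ one ⁆ 5 (B - y)
  block-remove {B} {y} block@(size , _ , _) y∈B =
    (λ x x∈one x∈B-y → one∉block block (subst (_∈ B) (x∈⁅y⁆⇒x≡y one x∈one) (p─q⊆p B ⁅ y ⁆ x∈B-y))) ,
    size-6-remove size y∈B , clean⇒independent-with-one (block⇒clean block y∈B)

  -- The unique element completing such a 5-set S to a block: 1 + ∑ S.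
  completion : Subset q → Fin q
  completion S = from (1# + ∑ S)

  to-completion : ∀ S → ∑ S + to (completion S) ≡ 1#
  to-completion S = begin
    ∑ S + to (completion S)  ≡⟨ cong (∑ S +_) (to-from _) ⟩
    ∑ S + (1# + ∑ S)         ≡⟨ x∙yz≈y∙xz (∑ S) 1# (∑ S) ⟩
    1# + (∑ S + ∑ S)         ≡⟨ cong (1# +_) (x+x≡0 (∑ S)) ⟩
    1# + 0#                  ≡⟨ +-identityʳ 1# ⟩
    1#                       ∎
    where open ≡-Reasoning

  -- For an extension S of {1}, the completion is new: otherwise S - c ⊆ S
  -- would sum to 1.
  completion-∉ : ∀ {S} → Extension ⁅ one ⁆ 5 S → completion S ∉ S
  completion-∉ {S} (disj , _ , ind) c∈S =
    independent-with-one⇒sum≢1 (disj one (x∈⁅x⁆ one)) ind (p─q⊆p S ⁅ c ⁆)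
      (trans (move (trans (+-comm _ _) (sym (∑-remove c∈S)))) (to-completion S))
    where
    c : Fin q
    c = completion S

  extension-complete : ∀ {S} → (ext : Extension ⁅ one ⁆ 5 S) → Block (S ∪ ⁅ completion S ⁆)
  extension-complete {S} ext@(disj , size , ind) =
    clean⇒block size′ (trans (∑-insert c∉S) (to-completion S)) (x∈p∪q⁺ (inj₂ (x∈⁅x⁆ c)))
      (subst AllClean (sym (insert-remove c∉S)) (independent-with-one⇒clean (disj one (x∈⁅x⁆ one)) ind))
    where
    c : Fin q
    c = completion S
    c∉S : c ∉ S
    c∉S = completion-∉ ext
    size′ : ∣ S ∪ ⁅ c ⁆ ∣ ≡ 6
    size′ = trans (size-insert c∉S) (cong suc size)

  completion-remove : ∀ {B : Subset q} {y} → Block B → y ∈ B → completion (B - y) ≡ y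
  completion-remove {B} {y} (_ , ∑B≡1 , _) y∈B =
    trans (cong from (sym (move (trans (sym (∑-remove y∈B)) ∑B≡1)))) (from-to y)

  BlockPair : (Subset q → Set) → Subset q × Fin q → Set
  BlockPair Q (B , y) = (Block B × y ∈ B) × Q (B - y)

  count-block-pairs : ∀ {Q : Subset q → Set} {N} → CountIs (BlockPair Q) N → CountIs (λ S → Extension ⁅ one ⁆ 5 S × Q S) N
  count-block-pairs {Q} =
    count-bijection (λ (B , y) → B - y) (λ S → S ∪ ⁅ completion S ⁆ , completion S)
      (λ (B , y) ((block , y∈B) , q) → block-remove block y∈B , q)
      (λ S (ext , q) → (extension-complete ext , x∈p∪q⁺ (inj₂ (x∈⁅x⁆ _))) ,
                       subst Q (sym (insert-remove (completion-∉ ext))) q)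
      (λ (B , y) ((block , y∈B) , _) → let c≡y = completion-remove block y∈B in
         cong₂ _,_ (trans (cong (λ z → (B - y) ∪ ⁅ z ⁆) c≡y) (remove-insert y∈B)) c≡y)
      (λ S (ext , _) → insert-remove (completion-∉ ext))

  independent-one : Independent ⁅ one ⁆
  independent-one = independent-⊆ (λ m → x∈p∪q⁺ (inj₂ m)) (proj₂ (¬spans⇒extends independent-∅ ¬spans))
    where
    ¬spans : ¬ Spans ∅ one
    ¬spans (C , C⊆∅ , e) =
      0≢1 (trans (sym ∑-∅) (trans (cong ∑ (sym (⊆∅⇒≡∅ C⊆∅))) (trans (from≡⇒≡to e) to-one)))

  extends-one : ∀ x → ¬ to x ≡ 0# → ¬ to x ≡ 1# → Extends ⁅ one ⁆ x
  extends-one x ≢0 ≢1 = ¬spans⇒extends independent-one ¬spans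
    where
    ¬spans : ¬ Spans ⁅ one ⁆ x
    ¬spans (C , C⊆one , e) with one ∈? C
    ... | yes one∈C = ≢1 (trans (sym (from≡⇒≡to e)) (trans (cong ∑ C≡one) (trans (∑-singleton one) to-one)))
      where
      C≡one : C ≡ ⁅ one ⁆
      C≡one = ⊆-antisym C⊆one λ m → subst (_∈ C) (sym (x∈⁅y⁆⇒x≡y one m)) one∈C
    ... | no one∉C = ≢0 (trans (sym (from≡⇒≡to e)) (trans (cong ∑ C≡∅) ∑-∅))
      where
      C≡∅ : C ≡ ∅
      C≡∅ = ⊆∅⇒≡∅ λ m → ⊥-elim (one∉C (subst (_∈ C) (x∈⁅y⁆⇒x≡y one (C⊆one m)) m))

  -- Double counting (block, element): 6 · #Blocks = #(5-extensions of {1}).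
  blocks-equation : ∀ {N} → CountIs Block N → 5 ! * (N * 6) ≡ gaps 1 5
  blocks-equation {N} C =
    trans (count-extensions 5 independent-one (count-⇔ (λ _ → proj₁) (λ _ e → e , tt) (count-block-pairs by-element)))
      (cong (λ a → gaps a 5) (∣⁅x⁆∣≡1 one))
    where
    by-element : CountIs (BlockPair (λ _ → ⊤)) (N * 6)
    by-element = count-⇔ (λ _ pair → pair , tt) (λ _ → proj₁)
      (count-pairs C (λ B block → subst (CountIs _) (proj₁ block) (count-members B)))

  -- Through a fixed x ∈ X: 5 · #(blocks ∋ x) = #(4-extensions of {1, x}).
  blocks-through-equation : ∀ x → ¬ to x ≡ 0# → ¬ to x ≡ 1# → ∀ {N}
    → CountIs (λ B → Block B × x ∈ B) N → 4 ! * (N * 5) ≡ gaps 2 4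
  blocks-through-equation x ≢0 ≢1 {N} C =
    trans (count-extensions 4 (proj₂ x-extends) (count-extensions-through x-extends (count-block-pairs by-element)))
      (cong (λ a → gaps a 4) (trans (size-insert (proj₁ x-extends)) (cong suc (∣⁅x⁆∣≡1 one))))
    where
    x-extends : Extends ⁅ one ⁆ x
    x-extends = extends-one x ≢0 ≢1
    other-element : ∀ {B : Subset q} {y} → x ∈ B → y ∈ B - x → y ∈ B × x ∈ B - y
    other-element x∈B y∈B-x = p─q⊆p _ ⁅ x ⁆ y∈B-x , x∈p∧x≢y⇒x∈p-y x∈B λ { refl → ∈-⇒≢ y∈B-x refl }
    back : ∀ {B : Subset q} {y} → y ∈ B × x ∈ B - y → y ∈ B - x
    back (y∈B , x∈B-y) = x∈p∧x≢y⇒x∈p-y y∈B λ { refl → ∈-⇒≢ x∈B-y refl }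
    by-element : CountIs (BlockPair (x ∈_)) (N * 5)
    by-element = count-⇔
      (λ _ ((block , x∈B) , y∈B-x) → let (y∈B , x∈B-y) = other-element x∈B y∈B-x in (block , y∈B) , x∈B-y)
      (λ (B , y) ((block , y∈B) , x∈B-y) → (block , p─q⊆p B ⁅ y ⁆ x∈B-y) , back (y∈B , x∈B-y))
      (count-pairs C (λ B (block , x∈B) → subst (CountIs _) (size-6-remove (proj₁ block) x∈B) (count-members (B - x))))

  count-W₆ : CountIs (W F 6) (((q ∸ 2) * (q ∸ 4) * (q ∸ 8) * (q ∸ 16) * (q ∸ 32)) / 720)
  count-W₆ with count-Subset Block block?
  ... | N , C = subst (CountIs (W F 6)) (sym (divide-out 720 (begin
    N * 720                                                    ≡⟨ 720≡120·6 N ⟩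
    120 * (N * 6)                                              ≡⟨ blocks-equation C ⟩
    (q ∸ 2) * ((q ∸ 4) * ((q ∸ 8) * ((q ∸ 16) * ((q ∸ 32) * 1))))
                                                               ≡⟨ right-nested₅ (q ∸ 2) (q ∸ 4) (q ∸ 8) (q ∸ 16) (q ∸ 32) ⟩
    (q ∸ 2) * (q ∸ 4) * (q ∸ 8) * (q ∸ 16) * (q ∸ 32)          ∎)))
    (count-⇔ (λ _ → block⇒W) (λ _ → W⇒block) C)
    where open ≡-Reasoning

  count-W₆-through : ∀ x → ¬ to x ≡ 0# → ¬ to x ≡ 1#
    → CountIs (λ B → W F 6 B × x ∈ B) (((q ∸ 4) * (q ∸ 8) * (q ∸ 16) * (q ∸ 32)) / 120)
  count-W₆-through x ≢0 ≢1 with count-Subset (λ B → Block B × x ∈ B) (λ B → block? B ×-dec (x ∈? B))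
  ... | N , C = subst (CountIs _) (sym (divide-out 120 (begin
    N * 120                                                    ≡⟨ 120≡24·5 N ⟩
    24 * (N * 5)                                               ≡⟨ blocks-through-equation x ≢0 ≢1 C ⟩
    (q ∸ 4) * ((q ∸ 8) * ((q ∸ 16) * ((q ∸ 32) * 1)))
                                                               ≡⟨ right-nested₄ (q ∸ 4) (q ∸ 8) (q ∸ 16) (q ∸ 32) ⟩
    (q ∸ 4) * (q ∸ 8) * (q ∸ 16) * (q ∸ 32)                    ∎)))
    (count-⇔ (λ _ (block , x∈B) → block⇒W block , x∈B) (λ _ (w , x∈B) → W⇒block w , x∈B) C)
    where open ≡-Reasoning

corollary3p18 : (m : ℕ) → 6 ≤ m → (F : FiniteField (2 ^ m)) →
    ((x : Fin (2 ^ m)) → ¬ (Inverse.to (FiniteField.enum F) x ≡ FiniteField.0# F) → ¬ (Inverse.to (FiniteField.enum F) x ≡ FiniteField.1# F) →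
      CountIs (λ B → W F 6 B × x ∈ B) (((2 ^ m ∸ 4) * (2 ^ m ∸ 8) * (2 ^ m ∸ 16) * (2 ^ m ∸ 32)) / 120))
    × CountIs (W F 6) (((2 ^ m ∸ 2) * (2 ^ m ∸ 4) * (2 ^ m ∸ 8) * (2 ^ m ∸ 16) * (2 ^ m ∸ 32)) / 720)
-- A field of order 2^m (m ≥ 1) has characteristic two, so both counts apply.
corollary3p18 zero    ()
corollary3p18 (suc m) _  F = count-W₆-through , count-W₆
  where open Blocks F (FieldBasics.characteristic-two F (2 ^ m , refl))
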